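{- Let $s$ be a positive integer and let $\lambda$ be a partition whose remainder sequence $(\rho_1,\dots,\rho_m)$ modulo $s$ is strictly increasing, with row position sequence $(\gamma_1,\dots,\gamma_m)$. For $j=1,\dots,m$ let $\gamma'_j=\lceil\lambda_{\gamma_j}/s\rceil$. Then each of the cells $(\gamma_1,\gamma'_1),\dots,(\gamma_m,\gamma'_m)$ is an outer corner of the Ferrers diagram of the $s$-reduction $\lambda\!\downarrow_s=(\lfloor\lambda_1/s\rfloor,\dots,\lfloor\lambda_\ell/s\rfloor)$.
   Context: Partitions $\lambda=(\lambda_1\ge\dots\ge\lambda_\ell>0)$ are identified with Ferrers diagrams; cell $(i,j)$ is in row $i$, column $j$ (row $i$ consists of cells $(i,1),\dots,(i,\lambda_i)$; zero parts of the $s$-reduction give empty rows). An outer corner of a Ferrers diagram $\mu$ is a cell $z\notin\mu$ such that $\mu\cup\{z\}$ is a Ferrers diagram. The row position sequence is the increasing sequence $\gamma_1<\dots<\gamma_m$ of indices $i$ with $s\nmid\lambda_i$, and the remainder sequence is $\rho_j=\lambda_{\gamma_j}\bmod s$. -}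

module Defs where

open import Data.Nat using (ℕ; zero; suc; _+_; _∸_; _≤_; _<_; _≥_; NonZero)
open import Data.Nat.DivMod using (_/_)
open import Data.Nat.Divisibility using (_∣_; _∣?_)
open import Data.List using (List; []; _∷_; length; map; filter; upTo)
open import Data.List.Relation.Unary.All using (All)
open import Data.List.Relation.Unary.Linked using (Linked)
open import Data.Product using (_×_; _,_; Σ)
open import Data.Sum using (_⊎_)
open import Relation.Nullary using (¬_)
open import Relation.Nullary.Decidable using (¬?)
open import Relation.Binary.PropositionalEquality using (_≡_)

IsPartition : List ℕ → Set
IsPartition l = All (λ x → 0 < x) l × Linked _≥_ l

-- row l i : the i-th part (1-based); 0 if i = 0 or i > length l.
row : List ℕ → ℕ → ℕ
row []       _             = 0
row (x ∷ xs) zero          = 0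
row (x ∷ xs) (suc zero)    = x
row (x ∷ xs) (suc (suc k)) = row xs (suc k)

Cell : Set
Cell = ℕ × ℕ

InDiagram : List ℕ → Cell → Set
InDiagram l (i , j) = (1 ≤ i × i ≤ length l) × (1 ≤ j × j ≤ row l i)

OuterCorner : List ℕ → Cell → Set
OuterCorner μ z =
  ¬ InDiagram μ z ×
  Σ (List ℕ) λ ν → IsPartition ν ×
    (∀ c → (InDiagram ν c → InDiagram μ c ⊎ c ≡ z) × (InDiagram μ c ⊎ c ≡ z → InDiagram ν c))

-- s-reduction: (⌊λ₁/s⌋, …, ⌊λ_ℓ/s⌋), zero parts kept (empty rows).
reduce : (s : ℕ) → .{{NonZero s}} → List ℕ → List ℕ
reduce s l = map (λ x → x / s) l

ceilDiv : ℕ → (s : ℕ) → .{{NonZero s}} → ℕ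
ceilDiv a s = (a + (s ∸ 1)) / s

rowPositions : ℕ → List ℕ → List ℕ
rowPositions s l = filter (λ i → ¬? (s ∣? row l i)) (map suc (upTo (length l)))

remainders : (s : ℕ) → .{{NonZero s}} → List ℕ → List ℕ
remainders s l = map (λ i → row l i % s) (rowPositions s l)
  where open import Data.Nat.DivMod using (_%_)

{-# OPTIONS --safe #-}
-- Since s ∤ λ_γ, ⌈λ_γ / s⌉ = ⌊λ_γ / s⌋ + 1: the cell lies just past the end of row γ
-- of λ↓s, so it is an outer corner as soon as row γ − 1 of λ↓s is strictly longer.
-- If those two rows of λ↓s were equal, then λ_{γ−1} mod s ≥ λ_γ mod s > 0, so γ − 1
-- would be the row position just before γ, and the remainders would not increase there.
module Submission where

open import Defs
open import Data.Nat using (ℕ; NonZero; zero; suc; _+_; _*_; _≤_; _<_; _≥_; z≤n; s≤s; s≤s⁻¹; _≟_)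
open import Data.Nat.Properties
open import Data.Nat.DivMod
open import Data.Nat.Divisibility using (_∣_; _∣?_; m%n≡0⇒n∣m; n∣m⇒m%n≡0; n∣m*n)
open import Data.Nat.Tactic.RingSolver using (solve-∀)
open import Data.List using (List; []; _∷_; length; map; filter; upTo; applyUpTo)
open import Data.List.Properties using (length-map; map-upTo; filter-accept)
open import Data.List.Relation.Unary.All as All using (All; []; _∷_)
import Data.List.Relation.Unary.All.Properties as All
open import Data.List.Relation.Unary.Linked as Linked using (Linked; []; [-]; _∷_)
import Data.List.Relation.Unary.Linked.Properties as Linked
open import Data.Product using (_,_; _×_; proj₂)
open import Data.Sum using (_⊎_; inj₁; inj₂)
open import Function using (_∘_; _on_)
open import Relation.Nullary using (¬_; yes; no; contradiction)
open import Relation.Nullary.Decidable using (¬?)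
open import Relation.Unary using (Decidable)
open import Relation.Binary.PropositionalEquality
  using (_≡_; _≢_; refl; sym; trans; cong; cong₂; subst; subst₂; module ≡-Reasoning)

row-map : ∀ (f : ℕ → ℕ) → f 0 ≡ 0 → ∀ l i → row (map f l) i ≡ f (row l i)
row-map f f0≡0 []       i             = sym f0≡0
row-map f f0≡0 (x ∷ xs) zero          = sym f0≡0
row-map f f0≡0 (x ∷ xs) (suc zero)    = refl
row-map f f0≡0 (x ∷ xs) (suc (suc i)) = row-map f f0≡0 xs (suc i)

row>0⇒inRange : ∀ l i → 0 < row l i → 1 ≤ i × i ≤ length l
row>0⇒inRange (x ∷ xs) (suc zero)    _ = s≤s z≤n , s≤s z≤n
row>0⇒inRange (x ∷ xs) (suc (suc i)) p = s≤s z≤n , s≤s (proj₂ (row>0⇒inRange xs (suc i) p))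

inDiagram⁺ : ∀ l {i j} → 1 ≤ j → j ≤ row l i → InDiagram l (i , j)
inDiagram⁺ l {i} 1≤j j≤row = row>0⇒inRange l i (≤-trans 1≤j j≤row) , 1≤j , j≤row

linked⇒row-suc-≤ : ∀ {l} → Linked _≥_ l → ∀ i → row l (suc (suc i)) ≤ row l (suc i)
linked⇒row-suc-≤ []        i       = z≤n
linked⇒row-suc-≤ [-]       i       = z≤n
linked⇒row-suc-≤ (x≥y ∷ _) zero    = x≥y
linked⇒row-suc-≤ (_ ∷ l↓)  (suc i) = linked⇒row-suc-≤ l↓ i

row-suc-≤⇒linked : ∀ l → (∀ i → row l (suc (suc i)) ≤ row l (suc i)) → Linked _≥_ l
row-suc-≤⇒linked []           _ = []
row-suc-≤⇒linked (x ∷ [])     _ = [-]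
row-suc-≤⇒linked (x ∷ y ∷ xs) h = h 0 ∷ row-suc-≤⇒linked (y ∷ xs) (h ∘ suc)

row-zeroHead : ∀ {xs} → Linked _≥_ (0 ∷ xs) → ∀ i → row (0 ∷ xs) i ≡ 0
row-zeroHead _         zero          = refl
row-zeroHead _         (suc zero)    = refl
row-zeroHead [-]       (suc (suc i)) = refl
row-zeroHead (z≤n ∷ d) (suc (suc i)) = row-zeroHead d (suc i)

-- Reduced lists keep their empty rows; a partition witnessing an outer corner may not.
positivePrefix : List ℕ → List ℕ
positivePrefix []           = []
positivePrefix (zero  ∷ xs) = []
positivePrefix (suc x ∷ xs) = suc x ∷ positivePrefix xs

row-positivePrefix : ∀ {l} → Linked _≥_ l → ∀ i → row (positivePrefix l) i ≡ row l i
row-positivePrefix {[]}         _ i             = refl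
row-positivePrefix {zero ∷ xs}  d i             = sym (row-zeroHead d i)
row-positivePrefix {suc x ∷ xs} _ zero          = refl
row-positivePrefix {suc x ∷ xs} _ (suc zero)    = refl
row-positivePrefix {suc x ∷ xs} d (suc (suc i)) = row-positivePrefix (Linked.tail d) (suc i)

positivePrefix-isPartition : ∀ {l} → Linked _≥_ l → IsPartition (positivePrefix l)
positivePrefix-isPartition d = positive _ , decreasing d
  where
  positive : ∀ l → All (0 <_) (positivePrefix l)
  positive []           = []
  positive (zero  ∷ xs) = []
  positive (suc x ∷ xs) = s≤s z≤n ∷ positive xs
  decreasing : ∀ {l} → Linked _≥_ l → Linked _≥_ (positivePrefix l)
  decreasing {[]}                 _         = []
  decreasing {zero ∷ xs}          _         = []
  decreasing {suc x ∷ []}         _         = [-]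
  decreasing {suc x ∷ zero ∷ xs}  _         = [-]
  decreasing {suc x ∷ suc y ∷ xs} (x≥y ∷ d) = x≥y ∷ decreasing d

outerCorner-fromRows : ∀ {μ ν i} → Linked _≥_ ν →
  row ν i ≡ suc (row μ i) → (∀ j → j ≢ i → row ν j ≡ row μ j) →
  OuterCorner μ (i , suc (row μ i))
outerCorner-fromRows {μ} {ν} {i} ν↓ rowᵢ rowⱼ =
  (λ (_ , _ , z≤row) → 1+n≰n z≤row) ,
  positivePrefix ν , positivePrefix-isPartition ν↓ , λ c → to c , from c
  where
  ν⁺ = positivePrefix ν
  row-ν⁺ : ∀ j → row ν⁺ j ≡ row ν j
  row-ν⁺ = row-positivePrefix ν↓
  to : ∀ c → InDiagram ν⁺ c → InDiagram μ c ⊎ c ≡ (i , suc (row μ i))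
  to (j , b) (_ , 1≤b , b≤ν⁺) with j ≟ i | subst (b ≤_) (row-ν⁺ j) b≤ν⁺
  ... | no j≢i  | b≤ν = inj₁ (inDiagram⁺ μ 1≤b (subst (b ≤_) (rowⱼ j j≢i) b≤ν))
  ... | yes refl | b≤ν with m≤n⇒m<n∨m≡n (subst (b ≤_) rowᵢ b≤ν)
  ...   | inj₁ b<1+μᵢ = inj₁ (inDiagram⁺ μ 1≤b (s≤s⁻¹ b<1+μᵢ))
  ...   | inj₂ refl   = inj₂ refl
  from : ∀ c → InDiagram μ c ⊎ c ≡ (i , suc (row μ i)) → InDiagram ν⁺ c
  from (j , b) (inj₁ (_ , 1≤b , b≤μ)) = inDiagram⁺ ν⁺ 1≤b (subst (b ≤_) (sym (row-ν⁺ j)) (≤-trans b≤μ μ≤ν))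
    where
    μ≤ν : row μ j ≤ row ν j
    μ≤ν with j ≟ i
    ... | yes refl = subst (row μ i ≤_) (sym rowᵢ) (n≤1+n _)
    ... | no j≢i   = ≤-reflexive (sym (rowⱼ j j≢i))
  from _ (inj₂ refl) = inDiagram⁺ ν⁺ (s≤s z≤n) (≤-reflexive (sym (trans (row-ν⁺ i) rowᵢ)))

incrementAt : ℕ → List ℕ → List ℕ
incrementAt _       []       = []
incrementAt zero    (x ∷ xs) = suc x ∷ xs
incrementAt (suc p) (x ∷ xs) = x ∷ incrementAt p xs

row-incrementAt-≡ : ∀ p l → p < length l → row (incrementAt p l) (suc p) ≡ suc (row l (suc p))
row-incrementAt-≡ zero    (x ∷ xs) _         = refl
row-incrementAt-≡ (suc p) (x ∷ xs) (s≤s p<n) = row-incrementAt-≡ p xs p<n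

row-incrementAt-≢ : ∀ p l j → j ≢ suc p → row (incrementAt p l) j ≡ row l j
row-incrementAt-≢ p       []       j             _   = refl
row-incrementAt-≢ zero    (x ∷ xs) zero          _   = refl
row-incrementAt-≢ (suc p) (x ∷ xs) zero          _   = refl
row-incrementAt-≢ zero    (x ∷ xs) (suc zero)    j≢1 = contradiction refl j≢1
row-incrementAt-≢ zero    (x ∷ xs) (suc (suc j)) _   = refl
row-incrementAt-≢ (suc p) (x ∷ xs) (suc zero)    _   = refl
row-incrementAt-≢ (suc p) (x ∷ xs) (suc (suc j)) j≢p = row-incrementAt-≢ p xs (suc j) (j≢p ∘ cong suc)

outerCorner-endOfRow : ∀ {μ p} → Linked _≥_ μ → p < length μ →
  (p ≢ 0 → row μ (suc p) < row μ p) →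
  OuterCorner μ (suc p , suc (row μ (suc p)))
outerCorner-endOfRow {μ} {p} μ↓ p<n drop =
  outerCorner-fromRows {μ = μ} (row-suc-≤⇒linked ν ν↓) (row-incrementAt-≡ p μ p<n) (row-incrementAt-≢ p μ)
  where
  ν = incrementAt p μ
  open ≤-Reasoning
  ν↓ : ∀ k → row ν (suc (suc k)) ≤ row ν (suc k)
  ν↓ k with suc k ≟ p | k ≟ p
  ... | yes refl | _ = begin
    row ν (suc p)        ≡⟨ row-incrementAt-≡ p μ p<n ⟩
    suc (row μ (suc p))  ≤⟨ drop (λ ()) ⟩
    row μ p              ≡⟨ row-incrementAt-≢ p μ p (1+n≢n ∘ sym) ⟨
    row ν p              ∎
  ... | no _ | yes refl = begin
    row ν (suc (suc p))  ≡⟨ row-incrementAt-≢ p μ (suc (suc p)) 1+n≢n ⟩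
    row μ (suc (suc p))  ≤⟨ linked⇒row-suc-≤ μ↓ p ⟩
    row μ (suc p)        ≤⟨ n≤1+n _ ⟩
    suc (row μ (suc p))  ≡⟨ row-incrementAt-≡ p μ p<n ⟨
    row ν (suc p)        ∎
  ... | no 1+k≢p | no k≢p = begin
    row ν (suc (suc k))  ≡⟨ row-incrementAt-≢ p μ (suc (suc k)) (1+k≢p ∘ suc-injective) ⟩
    row μ (suc (suc k))  ≤⟨ linked⇒row-suc-≤ μ↓ k ⟩
    row μ (suc k)        ≡⟨ row-incrementAt-≢ p μ (suc k) (k≢p ∘ suc-injective) ⟨
    row ν (suc k)        ∎

filter-applyUpTo-consecutive : ∀ {A : Set} {P : A → Set} (P? : Decidable P) {R : A → A → Set} f n {k} →
  Linked R (filter P? (applyUpTo f n)) → suc k < n → P (f k) → P (f (suc k)) → R (f k) (f (suc k))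
filter-applyUpTo-consecutive P? f (suc (suc n)) {zero} linked _ Pf₀ Pf₁ =
  Linked.head (subst (Linked _) (trans (filter-accept P? Pf₀) (cong (f 0 ∷_) (filter-accept P? Pf₁))) linked)
filter-applyUpTo-consecutive P? f (suc n) {suc k} linked (s≤s k<n) Pfₖ Pfₖ₊₁ with P? (f 0)
... | yes _ = filter-applyUpTo-consecutive P? (f ∘ suc) n (Linked.tail linked) k<n Pfₖ Pfₖ₊₁
... | no _  = filter-applyUpTo-consecutive P? (f ∘ suc) n linked k<n Pfₖ Pfₖ₊₁

∤⇒%>0 : ∀ {m} o .{{_ : NonZero o}} → ¬ o ∣ m → 0 < m % o
∤⇒%>0 {m} o o∤m = n≢0⇒n>0 (o∤m ∘ m%n≡0⇒n∣m m o)

m≤n∧m/o≡n/o⇒m%o≤n%o : ∀ {m n} o .{{_ : NonZero o}} → m ≤ n → m / o ≡ n / o → m % o ≤ n % o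
m≤n∧m/o≡n/o⇒m%o≤n%o {m} {n} o m≤n m/o≡n/o = +-cancelʳ-≤ (n / o * o) (m % o) (n % o) (begin
  m % o + n / o * o  ≡⟨ cong (λ q → m % o + q * o) m/o≡n/o ⟨
  m % o + m / o * o  ≡⟨ m≡m%n+[m/n]*n m o ⟨
  m                  ≤⟨ m≤n ⟩
  n                  ≡⟨ m≡m%n+[m/n]*n n o ⟩
  n % o + n / o * o  ∎)
  where open ≤-Reasoning

/-strictMono-∤ : ∀ {m n} o .{{_ : NonZero o}} → m ≤ n → ¬ o ∣ m →
  (¬ o ∣ n → n % o < m % o) → m / o < n / o
/-strictMono-∤ {m} {n} o m≤n o∤m remainder-drops = ≤∧≢⇒< (/-monoˡ-≤ o m≤n) quotients-differ
  where
  quotients-differ : m / o ≢ n / o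
  quotients-differ m/o≡n/o = <⇒≱ (remainder-drops o∤n) m%o≤n%o
    where
    m%o≤n%o = m≤n∧m/o≡n/o⇒m%o≤n%o o m≤n m/o≡n/o
    o∤n : ¬ o ∣ n
    o∤n o∣n = <⇒≱ (∤⇒%>0 o o∤m) (≤-trans m%o≤n%o (≤-reflexive (n∣m⇒m%n≡0 n o o∣n)))

ceilDiv-∤ : ∀ a s .{{_ : NonZero s}} → ¬ s ∣ a → ceilDiv a s ≡ suc (a / s)
ceilDiv-∤ a s@(suc t) s∤a with a % s | m≡m%n+[m/n]*n a s | m%n<n a s | ∤⇒%>0 s s∤a
... | suc r | a≡ | 1+r<s | _ = begin
  (a + t) / s              ≡⟨ cong (λ x → (x + t) / s) a≡ ⟩
  (suc r + q * s + t) / s  ≡⟨ cong (_/ s) (regroup r q t) ⟩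
  (r + suc q * s) / s      ≡⟨ +-distrib-/-∣ʳ r (n∣m*n (suc q)) ⟩
  r / s + suc q * s / s    ≡⟨ cong₂ _+_ (m<n⇒m/n≡0 (<-trans (n<1+n r) 1+r<s)) (m*n/n≡m (suc q) s) ⟩
  suc q                    ∎
  where
  open ≡-Reasoning
  q = a / s
  regroup : ∀ r q t → suc r + q * suc t + t ≡ r + suc q * suc t
  regroup = solve-∀

row-reduce : ∀ s .{{_ : NonZero s}} l i → row (reduce s l) i ≡ row l i / s
row-reduce s = row-map (_/ s) (0/n≡0 s)

reduce-linked : ∀ s .{{_ : NonZero s}} {l} → Linked _≥_ l → Linked _≥_ (reduce s l)
reduce-linked s l↓ = Linked.map⁺ (Linked.map (/-monoˡ-≤ s) l↓)

proposition3p4 : (s : ℕ) → .{{_ : NonZero s}} → (lam : List ℕ) → IsPartition lam →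
    Linked _<_ (remainders s lam) →
    All (λ i → OuterCorner (reduce s lam) (i , ceilDiv (row lam i) s)) (rowPositions s lam)
proposition3p4 s lam (_ , lam↓) ρ↑ =
  All.zipWith (λ (s∤λᵢ , corner) → corner s∤λᵢ)
    (All.all-filter P? (map suc (upTo n)) , All.filter⁺ P? cornerAtRowPosition)
  where
  n = length lam
  μ = reduce s lam
  P? : Decidable (λ i → ¬ s ∣ row lam i)
  P? i = ¬? (s ∣? row lam i)
  remainder : ℕ → ℕ
  remainder i = row lam i % s
  positions↑ : Linked (_<_ on remainder) (filter P? (applyUpTo suc n))
  positions↑ = subst (Linked (_<_ on remainder) ∘ filter P?) (map-upTo suc n) (Linked.map⁻ ρ↑)
  reduced-drop : ∀ {k} → k < n → ¬ s ∣ row lam (suc k) → k ≢ 0 → row μ (suc k) < row μ k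
  reduced-drop {zero}  _   _    0≢0 = contradiction refl 0≢0
  reduced-drop {suc q} k<n s∤λₖ _   = subst₂ _<_ (sym (row-reduce s lam _)) (sym (row-reduce s lam _))
    (/-strictMono-∤ s (linked⇒row-suc-≤ lam↓ q) s∤λₖ
      (λ s∤λₖ₋₁ → filter-applyUpTo-consecutive P? suc n positions↑ k<n s∤λₖ₋₁ s∤λₖ))
  cornerAt : ∀ {k} → k < n → ¬ s ∣ row lam (suc k) → OuterCorner μ (suc k , ceilDiv (row lam (suc k)) s)
  cornerAt {k} k<n s∤λₖ rewrite ceilDiv-∤ _ s s∤λₖ | sym (row-reduce s lam (suc k)) =
    outerCorner-endOfRow (reduce-linked s lam↓) (subst (k <_) (sym (length-map _ lam)) k<n) (reduced-drop k<n s∤λₖ)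
  cornerAtRowPosition : All (λ i → ¬ s ∣ row lam i → OuterCorner μ (i , ceilDiv (row lam i) s)) (map suc (upTo n))
  cornerAtRowPosition = All.map⁺ (All.map cornerAt (All.all-upTo n))
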